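{- A shift space $X$ is eventually dendric if and only if there is an integer $n\ge0$ such that every word $w\in LS_{\ge n}(X)$ has exactly one right extension $wb$ with $b\in A$ belonging to $LS_{\ge n+1}(X)$, and this extension moreover satisfies $\ell(wb)=\ell(w)$.
   Context: A shift space on a finite alphabet $A$ is a closed shift-invariant subset of $A^{\mathbb Z}$; $\mathcal L(X)$ is its set of finite factors, $\mathcal L_n(X)$ those of length $n$, $\mathcal L_{\ge n}(X)=\bigcup_{k\ge n}\mathcal L_k(X)$. For $w\in\mathcal L(X)$: $L_1(w)=\{a\in A: aw\in\mathcal L(X)\}$, $R_1(w)=\{b\in A: wb\in\mathcal L(X)\}$, $\ell(w)=\mathrm{Card}\,L_1(w)$; the extension graph $\mathcal E_1(w)$ is the undirected bipartite graph with vertex set the disjoint union of $L_1(w)$ and $R_1(w)$ and edges the pairs $(a,b)$ with $awb\in\mathcal L(X)$. A word $w$ is left-special if $\ell(w)>1$; $LS_{\ge n}(X)$ denotes the set of left-special words of $\mathcal L(X)$ of length at least $n$. $X$ is eventually dendric if there is $m\ge0$ such that $\mathcal E_1(w)$ is a tree for every $w\in\mathcal L_{\ge m}(X)$. -}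

module Defs where

open import Level using (0ℓ)
open import Data.Nat using (ℕ; zero; suc; _≤_; _<_)
open import Data.Integer as ℤ using (ℤ; 1ℤ; ∣_∣) renaming (_+_ to _+ℤ_; _-_ to _-ℤ_)
open import Data.Fin using (Fin)
open import Data.List using (List; []; _∷_; length; _∷ʳ_)
open import Data.List.Relation.Unary.All using (All)
open import Data.List.Relation.Unary.Linked using (Linked)
open import Data.List.Relation.Unary.Unique.Propositional using (Unique)
open import Data.Product using (Σ; ∃; _×_; _,_)
open import Data.Sum using (_⊎_; inj₁; inj₂)
open import Data.Unit using (⊤)
open import Data.Empty using (⊥)
open import Function using (_∘_; _⇔_)
open import Function.Definitions using (Injective)
open import Relation.Binary.PropositionalEquality using (_≡_)

Config : ℕ → Set
Config k = ℤ → Fin k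

Word : ℕ → Set
Word k = List (Fin k)

Window : ∀ {k} → Config k → ℤ → Word k → Set
Window x i []       = ⊤
Window x i (a ∷ w)  = x i ≡ a × Window x (i +ℤ 1ℤ) w

σ : ∀ {k} → Config k → Config k
σ x i = x (i +ℤ 1ℤ)

σ⁻¹ : ∀ {k} → Config k → Config k
σ⁻¹ x i = x (i -ℤ 1ℤ)

record ShiftSpace (k : ℕ) : Set₁ where
  field
    _∈X : Config k → Set
    σ-closed   : ∀ x → x ∈X → σ x ∈X
    σ⁻¹-closed : ∀ x → x ∈X → σ⁻¹ x ∈X
    -- topological closedness: if every cylinder [x_{-n} .. x_n]
    -- around x meets X, then x ∈ X
    closed : ∀ x → (∀ (n : ℕ) → Σ (Config k) λ y → y ∈X × (∀ j → ∣ j ∣ ≤ n → y j ≡ x j)) → x ∈X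

open ShiftSpace public

module _ {k : ℕ} (X : ShiftSpace k) where

  InL : Word k → Set
  InL w = Σ (Config k) λ x → Σ ℤ λ i → (_∈X X x) × Window x i w

  L₁ : Word k → Fin k → Set
  L₁ w a = InL (a ∷ w)

  R₁ : Word k → Fin k → Set
  R₁ w b = InL (w ∷ʳ b)

HasCard : ∀ {k} → (Fin k → Set) → ℕ → Set
HasCard {k} P n = Σ (Fin n → Fin k) λ f → Injective _≡_ _≡_ f × (∀ a → P a ⇔ (∃ λ i → f i ≡ a))

module _ {k : ℕ} (X : ShiftSpace k) where

  ℓ≡ : Word k → ℕ → Set
  ℓ≡ w n = HasCard (L₁ X w) n

  LeftSpecial : Word k → Set
  LeftSpecial w = InL X w × Σ ℕ λ n → ℓ≡ w n × 1 < n

  LS≥ : ℕ → Word k → Set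
  LS≥ n w = LeftSpecial w × n ≤ length w

record Graph (V : Set) : Set₁ where
  field
    Vert : V → Set
    Adj  : V → V → Set

module _ {V : Set} (G : Graph V) where
  open Graph G

  data Walk : V → V → Set where
    here : ∀ {u} → Vert u → Walk u u
    step : ∀ {u v t} → Vert u → Adj u v → Walk v t → Walk u t

  Connected : Set
  Connected = ∀ u v → Vert u → Vert v → Walk u v

  Cycle : Set
  Cycle = Σ V λ v → Σ (List V) λ vs →
            2 ≤ length vs × All Vert (v ∷ vs) × Unique (v ∷ vs)
            × Linked Adj ((v ∷ vs) ∷ʳ v)

  Acyclic : Set
  Acyclic = Cycle → ⊥

  IsTree : Set
  IsTree = Connected × Acyclic

module _ {k : ℕ} (X : ShiftSpace k) where

  E₁ : Word k → Graph (Fin k ⊎ Fin k)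
  E₁ w = record { Vert = vert ; Adj = adj }
    where
    vert : Fin k ⊎ Fin k → Set
    vert (inj₁ a) = L₁ X w a
    vert (inj₂ b) = R₁ X w b
    adj : Fin k ⊎ Fin k → Fin k ⊎ Fin k → Set
    adj (inj₁ a) (inj₂ b) = InL X (a ∷ (w ∷ʳ b))
    adj (inj₂ b) (inj₁ a) = InL X (a ∷ (w ∷ʳ b))
    adj (inj₁ _) (inj₁ _) = ⊥
    adj (inj₂ _) (inj₂ _) = ⊥

  EventuallyDendric : Set
  EventuallyDendric = Σ ℕ λ m → ∀ w → InL X w → m ≤ length w → IsTree (E₁ w)

  UniqueLSExtension : ℕ → Set
  UniqueLSExtension n =
    ∀ w → LS≥ X n w →
      Σ (Fin k) λ b →
        LS≥ X (suc n) (w ∷ʳ b)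
        × (∀ b' → LS≥ X (suc n) (w ∷ʳ b') → b' ≡ b)
        × (Σ ℕ λ m → ℓ≡ X (w ∷ʳ b) m × ℓ≡ X w m)

module Submission where

-- (⇐) Let |w| ≥ n.  If w is left special and wb₀ is its left-special
-- extension, then L₁(wb₀) ⊆ L₁(w) have the same size, so every left letter is
-- joined to b₀ in ℰ₁(w), while every other right letter has at most one
-- neighbour.  If w is not left special, ℰ₁(w) is a star around its unique left
-- letter.  Both are instances of one graph criterion: every vertex reaches a
-- hub c, and every middle edge of a path p – r – s – q with p ≠ s, r ≠ q has c
-- as an endpoint; such a graph is a tree.
--
-- (⇒) Let ℰ₁(w) be a tree whenever |w| ≥ m.  Give every left-special word v
-- the weight (k+1)^ℓ(v), and let Φ(N) be the total weight of the words of
-- length N.  If v is left special and some left-special vb₀ has ℓ(vb₀) = ℓ(v),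
-- a second left-special extension would close a 4-cycle in ℰ₁(v), so the
-- weight of v passes unchanged to its extensions; otherwise every extension
-- weighs at most (k+1)^(ℓ(v)-1) and the total strictly drops, since
-- k·(k+1)^(ℓ(v)-1) < (k+1)^ℓ(v).  So Φ is nonincreasing from m on, hence
-- (classically) eventually constant, and from then on only the first case
-- occurs, which is the right-hand side of the proposition.

open import Defs
open import Level using (0ℓ)
open import Axiom.ExcludedMiddle using (ExcludedMiddle)
open import Data.Nat using (ℕ; zero; suc; _+_; _≤_; _<_; _≤′_; ≤′-refl; ≤′-step; z≤n; s≤s; _*_; _^_; pred; >-nonZero)
open import Data.Nat.Properties
  using ( ≤-refl; ≤-trans; ≤-antisym; ≤-reflexive; <-≤-trans; <⇒≤; ≤-pred; ≮⇒≥; ≤∧≢⇒<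
        ; <⇒≤pred; n≮0; 1+n≰n; <-irrefl; n<1+n; n≤1+n; suc-injective; ≤⇒≤′; ≤′⇒≤; suc-pred
        ; +-mono-≤; +-mono-<-≤; +-mono-≤-<; +-identityʳ; +-comm; *-monoˡ-<; ^-monoʳ-≤; m^n≢0
        ; +-0-commutativeMonoid; module ≤-Reasoning )
open import Data.Integer as ℤ using (1ℤ) renaming (_+_ to _+ℤ_; _-_ to _-ℤ_)
import Data.Integer.Properties as ℤP
open import Data.Fin using (Fin; zero; suc; _≟_; punchIn)
import Data.Fin.Properties as FinP
open import Data.List using (List; []; _∷_; length; _∷ʳ_)
import Data.List.Properties as ListP
open import Data.List.Relation.Unary.All using ([]; _∷_)
open import Data.List.Relation.Unary.Linked using ([-]; _∷_)
open import Data.List.Relation.Unary.AllPairs using ([]; _∷_)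
open import Data.Product using (Σ; ∃; _×_; _,_; proj₁; proj₂)
open import Data.Sum using (_⊎_; inj₁; inj₂)
open import Data.Unit using (tt)
open import Data.Empty using (⊥; ⊥-elim)
open import Function using (_∘_; id; case_of_; _⇔_; mk⇔; Equivalence)
open import Function.Definitions using (Injective)
open import Relation.Binary.Definitions using (Symmetric)
open import Relation.Nullary using (Dec; yes; no; ¬_)
open import Relation.Binary.PropositionalEquality
  using (_≡_; _≢_; refl; sym; trans; cong; subst; ≢-sym; module ≡-Reasoning)
open import Algebra.Properties.CommutativeMonoid.Sum +-0-commutativeMonoid
  using (sum; sum-syntax; sum-remove; sum-cong-≗; sum-replicate-zero)


sum-mono : ∀ {n} {h h' : Fin n → ℕ} → (∀ b → h b ≤ h' b) → sum h ≤ sum h'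
sum-mono {zero}  _  = z≤n
sum-mono {suc n} le = +-mono-≤ (le zero) (sum-mono (le ∘ suc))

sum-strict : ∀ {n} {h h' : Fin n → ℕ} → (∀ b → h b ≤ h' b) →
             ∀ b₀ → h b₀ < h' b₀ → sum h < sum h'
sum-strict le zero     lt = +-mono-<-≤ lt (sum-mono (le ∘ suc))
sum-strict le (suc b₀) lt = +-mono-≤-< (le zero) (sum-strict (le ∘ suc) b₀ lt)

sum-bound : ∀ {n} {h : Fin n → ℕ} {B} → (∀ b → h b ≤ B) → sum h ≤ n * B
sum-bound {zero}  _  = z≤n
sum-bound {suc n} le = +-mono-≤ (le zero) (sum-bound (le ∘ suc))

sum-supported : ∀ {n} (h : Fin n → ℕ) b₀ → (∀ b → b ≢ b₀ → h b ≡ 0) → sum h ≡ h b₀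
sum-supported {suc n} h b₀ vanish = begin
  sum h                                ≡⟨ sum-remove h ⟩
  h b₀ + sum (h ∘ punchIn b₀)          ≡⟨ cong (h b₀ +_) others ⟩
  h b₀ + 0                             ≡⟨ +-identityʳ (h b₀) ⟩
  h b₀                                 ∎
  where
  open ≡-Reasoning
  others : sum (h ∘ punchIn b₀) ≡ 0
  others = trans (sum-cong-≗ (λ j → vanish (punchIn b₀ j) (FinP.punchInᵢ≢i b₀ j)))
                 (sum-replicate-zero n)


weight : {P : Set} → Dec P → ℕ → ℕ
weight (yes _) x = x
weight (no _)  _ = 0

weight-yes : ∀ {P : Set} (d : Dec P) {x} → P → weight d x ≡ x
weight-yes (yes _) _ = refl
weight-yes (no ¬p) p = ⊥-elim (¬p p)

weight-no : ∀ {P : Set} (d : Dec P) {x} → ¬ P → weight d x ≡ 0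
weight-no (yes p) ¬p = ⊥-elim (¬p p)
weight-no (no _)  _  = refl

weight-bound : ∀ {P : Set} (d : Dec P) {x y} → (P → x ≤ y) → weight d x ≤ y
weight-bound (yes p) x≤y = x≤y p
weight-bound (no _)  _   = z≤n


sumWords : ∀ {k} → ℕ → (Word k → ℕ) → ℕ
sumWords zero    h = h []
sumWords (suc n) h = ∑[ a < _ ] sumWords n (h ∘ (a ∷_))

sumWords-∷ʳ : ∀ {k} n (h : Word k → ℕ) →
              sumWords (suc n) h ≡ sumWords n (λ v → ∑[ b < k ] h (v ∷ʳ b))
sumWords-∷ʳ zero    h = refl
sumWords-∷ʳ (suc n) h = sum-cong-≗ (λ a → sumWords-∷ʳ n (h ∘ (a ∷_)))

sumWords-mono : ∀ {k} n {h h' : Word k → ℕ} →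
                (∀ u → length u ≡ n → h u ≤ h' u) → sumWords n h ≤ sumWords n h'
sumWords-mono zero    le = le [] refl
sumWords-mono (suc n) le = sum-mono (λ a → sumWords-mono n (λ u ∣u∣ → le (a ∷ u) (cong suc ∣u∣)))

sumWords-strict : ∀ {k} n {h h' : Word k → ℕ} →
                  (∀ u → length u ≡ n → h u ≤ h' u) →
                  ∀ u₀ → length u₀ ≡ n → h u₀ < h' u₀ → sumWords n h < sumWords n h'
sumWords-strict zero    le []       _     lt = lt
sumWords-strict (suc n) le (a ∷ u₀) ∣u₀∣ lt =
  sum-strict (λ b → sumWords-mono n (λ u ∣u∣ → le (b ∷ u) (cong suc ∣u∣))) a
             (sumWords-strict n (λ u ∣u∣ → le (a ∷ u) (cong suc ∣u∣)) u₀ (suc-injective ∣u₀∣) lt)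


module _ (em : ExcludedMiddle 0ℓ) (f : ℕ → ℕ) (m : ℕ)
         (antitone : ∀ N → m ≤ N → f (suc N) ≤ f N) where

  descend : ∀ {m' N} → m ≤ m' → m' ≤′ N → f N ≤ f m'
  descend _     ≤′-refl            = ≤-refl
  descend m≤m' (≤′-step {N} m'≤N) =
    ≤-trans (antitone N (≤-trans m≤m' (≤′⇒≤ m'≤N))) (descend m≤m' m'≤N)

  constant-or-drop : ∀ m' → m ≤ m' →
    (Σ ℕ λ N₀ → m ≤ N₀ × (∀ N → N₀ ≤ N → f (suc N) ≡ f N)) ⊎
    (Σ ℕ λ m'' → m ≤ m'' × f m'' < f m')
  constant-or-drop m' m≤m' with em {Σ ℕ λ N → m' ≤ N × f (suc N) < f N}
  ... | no never = inj₁ (m' , m≤m' , λ N m'≤N →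
          ≤-antisym (antitone N (≤-trans m≤m' m'≤N)) (≮⇒≥ λ lt → never (N , m'≤N , lt)))
  ... | yes (N , m'≤N , lt) = inj₂ (suc N , ≤-trans m≤m' (≤-trans m'≤N (n≤1+n N)) ,
          <-≤-trans lt (descend m≤m' (≤⇒≤′ m'≤N)))

  -- A natural-number sequence that is nonincreasing from m on is eventually
  -- constant; the value f m bounds the number of drops.
  eventually-constant : Σ ℕ λ N₀ → m ≤ N₀ × (∀ N → N₀ ≤ N → f (suc N) ≡ f N)
  eventually-constant = from m ≤-refl (f m) ≤-refl
    where
    from : ∀ m' → m ≤ m' → ∀ B → f m' ≤ B → Σ ℕ λ N₀ → m ≤ N₀ × (∀ N → N₀ ≤ N → f (suc N) ≡ f N)
    from m' m≤m' B bound with constant-or-drop m' m≤m'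
    ... | inj₁ constant = constant
    from m' m≤m' zero    bound | inj₂ (_ , _ , lt) = ⊥-elim (n≮0 (<-≤-trans lt bound))
    from m' m≤m' (suc B) bound | inj₂ (m'' , m≤m'' , lt) = from m'' m≤m'' B (≤-pred (<-≤-trans lt bound))


module _ {n : ℕ} where

  enumerated : ∀ {P : Fin n → Set} {p} ((f , _ , img) : HasCard P p) → ∀ i → P (f i)
  enumerated (f , _ , img) i = Equivalence.from (img (f i)) (i , refl)

  -- Cardinality is monotone: P ⊆ Q injects the enumeration of P into that of Q.
  card-mono : ∀ {P Q : Fin n → Set} {p q} → (∀ a → P a → Q a) →
              HasCard P p → HasCard Q q → p ≤ q
  card-mono P⊆Q cP@(f , f-inj , _) (g , g-inj , g-img) = FinP.injective⇒≤ position-inj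
    where
    position : ∀ i → ∃ λ j → g j ≡ f i
    position i = Equivalence.to (g-img (f i)) (P⊆Q (f i) (enumerated cP i))
    position-inj : Injective _≡_ _≡_ (proj₁ ∘ position)
    position-inj {i} {j} e =
      f-inj (trans (sym (proj₂ (position i))) (trans (cong g e) (proj₂ (position j))))

  card-unique : ∀ {P : Fin n → Set} {p q} → HasCard P p → HasCard P q → p ≡ q
  card-unique cp cq = ≤-antisym (card-mono (λ _ → id) cp cq) (card-mono (λ _ → id) cq cp)

  card-⇔ : ∀ {P Q : Fin n → Set} {p} → (∀ a → P a ⇔ Q a) → HasCard P p → HasCard Q p
  card-⇔ P⇔Q (f , f-inj , img) =
    f , f-inj , λ a → mk⇔ (Equivalence.to (img a) ∘ Equivalence.from (P⇔Q a))
                          (Equivalence.to (P⇔Q a) ∘ Equivalence.from (img a))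

  two⇒card>1 : ∀ {P : Fin n → Set} {p} a a' → a ≢ a' → P a → P a' → HasCard P p → 1 < p
  two⇒card>1 {p = zero} a _ _ pa _ (_ , _ , img) with Equivalence.to (img a) pa
  ... | () , _
  two⇒card>1 {p = suc zero} a a' a≢a' pa pa' (_ , _ , img)
    with Equivalence.to (img a) pa | Equivalence.to (img a') pa'
  ... | zero , fa | zero , fa' = ⊥-elim (a≢a' (trans (sym fa) fa'))
  two⇒card>1 {p = suc (suc p)} _ _ _ _ _ _ = s≤s (s≤s z≤n)

  card>1⇒two : ∀ {P : Fin n → Set} {p} → 1 < p → HasCard P p →
               Σ (Fin n) λ a → Σ (Fin n) λ a' → a ≢ a' × P a × P a'
  card>1⇒two {p = suc zero} (s≤s ()) _
  card>1⇒two {p = suc (suc p)} _ c@(f , f-inj , _) =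
    f zero , f (suc zero) , (λ e → 0≢1 (f-inj e)) , enumerated c zero , enumerated c (suc zero)
    where
    0≢1 : Fin.zero {suc p} ≢ suc zero
    0≢1 ()

  card-insert : ∀ {P : Fin n → Set} {p} a → ¬ P a → HasCard P p →
                HasCard (λ x → P x ⊎ x ≡ a) (suc p)
  card-insert {P} {p} a ¬pa (f , f-inj , img) = f⁺ , f⁺-inj , λ x → mk⇔ (to x) (from x)
    where
    f⁺ : Fin (suc p) → Fin n
    f⁺ zero    = a
    f⁺ (suc i) = f i
    f≢a : ∀ i → f i ≢ a
    f≢a i e = ¬pa (subst P e (enumerated (f , f-inj , img) i))
    f⁺-inj : Injective _≡_ _≡_ f⁺
    f⁺-inj {zero}  {zero}  _ = refl
    f⁺-inj {zero}  {suc j} e = ⊥-elim (f≢a j (sym e))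
    f⁺-inj {suc i} {zero}  e = ⊥-elim (f≢a i e)
    f⁺-inj {suc i} {suc j} e = cong suc (f-inj e)
    to : ∀ x → (P x ⊎ x ≡ a) → ∃ λ i → f⁺ i ≡ x
    to x (inj₁ px) = let (i , fi) = Equivalence.to (img x) px in suc i , fi
    to x (inj₂ x≡a) = zero , sym x≡a
    from : ∀ x → (∃ λ i → f⁺ i ≡ x) → P x ⊎ x ≡ a
    from x (zero , a≡x)  = inj₂ (sym a≡x)
    from x (suc i , fi) = inj₁ (Equivalence.from (img x) (i , fi))

  card-⊆-⊇ : ExcludedMiddle 0ℓ → ∀ {P Q : Fin n → Set} {p} → (∀ a → P a → Q a) →
             HasCard P p → HasCard Q p → ∀ a → Q a → P a
  card-⊆-⊇ em {P} {Q} P⊆Q cP cQ a qa with em {P a}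
  ... | yes pa = pa
  ... | no ¬pa = ⊥-elim (1+n≰n (card-mono P∪a⊆Q (card-insert a ¬pa cP) cQ))
    where
    P∪a⊆Q : ∀ x → P x ⊎ x ≡ a → Q x
    P∪a⊆Q x (inj₁ px)  = P⊆Q x px
    P∪a⊆Q x (inj₂ refl) = qa

card-nonzero : ∀ {n} {P : Fin (suc n) → Set} {p} →
               HasCard (P ∘ suc) p → HasCard (λ a → P a × a ≢ zero) p
card-nonzero {P = P} {p} (f , f-inj , img) = suc ∘ f , f-inj ∘ FinP.suc-injective , shifted
  where
  shifted : ∀ a → (P a × a ≢ zero) ⇔ (∃ λ i → suc (f i) ≡ a)
  shifted zero    = mk⇔ (λ (_ , 0≢0) → ⊥-elim (0≢0 refl)) (λ { (_ , ()) })
  shifted (suc a) = mk⇔ (λ (pa , _) → let (i , fi) = Equivalence.to (img a) pa in i , cong suc fi)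
                        (λ (i , fi) → Equivalence.from (img a) (i , FinP.suc-injective fi) , λ ())

card-exists : ExcludedMiddle 0ℓ → ∀ {n} (P : Fin n → Set) → Σ ℕ (HasCard P)
card-exists em {zero}  P = 0 , (λ ()) , (λ {i} → ⊥-elim (FinP.¬Fin0 i)) , λ ()
card-exists em {suc n} P with card-exists em (P ∘ suc) | em {P zero}
... | p , c | yes p0 = suc p , card-⇔ with-zero (card-insert zero (λ (_ , 0≢0) → 0≢0 refl) (card-nonzero c))
  where
  with-zero : ∀ a → ((P a × a ≢ zero) ⊎ a ≡ zero) ⇔ P a
  with-zero zero    = mk⇔ (λ _ → p0) (λ _ → inj₂ refl)
  with-zero (suc a) = mk⇔ (λ { (inj₁ (pa , _)) → pa ; (inj₂ ()) }) (λ pa → inj₁ (pa , λ ()))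
... | p , c | no ¬p0 = p , card-⇔ without-zero (card-nonzero c)
  where
  without-zero : ∀ a → (P a × a ≢ zero) ⇔ P a
  without-zero zero    = mk⇔ (λ (_ , 0≢0) → ⊥-elim (0≢0 refl)) (λ p0 → ⊥-elim (¬p0 p0))
  without-zero (suc a) = mk⇔ proj₁ (λ pa → pa , λ ())


module _ {V : Set} (G : Graph V) where
  open Graph G

  infixr 5 _++ʷ_
  _++ʷ_ : ∀ {u v t} → Walk G u v → Walk G v t → Walk G u t
  here _       ++ʷ q = q
  step vu e p  ++ʷ q = step vu e (p ++ʷ q)

  walk-source : ∀ {u t} → Walk G u t → Vert u
  walk-source (here vu)     = vu
  walk-source (step vu _ _) = vu

  reverse : Symmetric Adj → ∀ {u t} → Walk G u t → Walk G t u
  reverse Adj-sym (here vu)     = here vu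
  reverse Adj-sym (step vu e p) = reverse Adj-sym p ++ʷ step (walk-source p) (Adj-sym e) (here vu)

  connected-via-hub : Symmetric Adj → ∀ c → (∀ u → Vert u → Walk G u c) → Connected G
  connected-via-hub Adj-sym c reach u v vu vv = reach u vu ++ʷ reverse Adj-sym (reach v vv)

  four-cycle : ∀ {x₀ x₁ x₂ x₃} → Vert x₀ → Vert x₁ → Vert x₂ → Vert x₃ →
               x₀ ≢ x₁ → x₀ ≢ x₂ → x₀ ≢ x₃ → x₁ ≢ x₂ → x₁ ≢ x₃ → x₂ ≢ x₃ →
               Adj x₀ x₁ → Adj x₁ x₂ → Adj x₂ x₃ → Adj x₃ x₀ → Cycle G
  four-cycle {x₀} {x₁} {x₂} {x₃} v₀ v₁ v₂ v₃ d₀₁ d₀₂ d₀₃ d₁₂ d₁₃ d₂₃ e₀₁ e₁₂ e₂₃ e₃₀ =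
    x₀ , x₁ ∷ x₂ ∷ x₃ ∷ [] , s≤s (s≤s z≤n) , v₀ ∷ v₁ ∷ v₂ ∷ v₃ ∷ [] ,
    (d₀₁ ∷ d₀₂ ∷ d₀₃ ∷ []) ∷ (d₁₂ ∷ d₁₃ ∷ []) ∷ (d₂₃ ∷ []) ∷ [] ∷ [] ,
    e₀₁ ∷ e₁₂ ∷ e₂₃ ∷ e₃₀ ∷ [-]

  InnerEdgesMeet : V → Set
  InnerEdgesMeet c = ∀ {p r s q} → Adj p r → Adj r s → Adj s q → p ≢ s → r ≢ q → r ≡ c ⊎ s ≡ c

  module _ {c : V} (inner : InnerEdgesMeet c) where

    -- Then the middle vertex of a path x₀ – … – x₄ without backtracking is c,
    -- being an endpoint of both of its edges x₁ – x₂ and x₂ – x₃.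
    middle-is-c : ∀ {x₀ x₁ x₂ x₃ x₄} → Adj x₀ x₁ → Adj x₁ x₂ → Adj x₂ x₃ → Adj x₃ x₄ →
                  x₀ ≢ x₂ → x₁ ≢ x₃ → x₂ ≢ x₄ → x₂ ≡ c
    middle-is-c e₀₁ e₁₂ e₂₃ e₃₄ d₀₂ d₁₃ d₂₄
      with inner e₀₁ e₁₂ e₂₃ d₀₂ d₁₃ | inner e₁₂ e₂₃ e₃₄ d₁₃ d₂₄
    ... | inj₂ x₂≡c | _         = x₂≡c
    ... | _         | inj₁ x₂≡c = x₂≡c
    ... | inj₁ x₁≡c | inj₂ x₃≡c = ⊥-elim (d₁₃ (trans x₁≡c (sym x₃≡c)))

    -- Hence no path x₀ – … – x₅ without backtracking has x₂ ≠ x₃, since both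
    -- would be c.
    no-long-path : ∀ {x₀ x₁ x₂ x₃ x₄ x₅} →
                   Adj x₀ x₁ → Adj x₁ x₂ → Adj x₂ x₃ → Adj x₃ x₄ → Adj x₄ x₅ →
                   x₀ ≢ x₂ → x₁ ≢ x₃ → x₂ ≢ x₄ → x₃ ≢ x₅ → x₂ ≢ x₃ → ⊥
    no-long-path e₀₁ e₁₂ e₂₃ e₃₄ e₄₅ d₀₂ d₁₃ d₂₄ d₃₅ d₂₃ =
      d₂₃ (trans (middle-is-c e₀₁ e₁₂ e₂₃ e₃₄ d₀₂ d₁₃ d₂₄)
                 (sym (middle-is-c e₁₂ e₂₃ e₃₄ e₄₅ d₁₃ d₂₄ d₃₅)))

    -- Going around a cycle v, y₁, …, yₘ, v (from v, wrapping around when m < 5)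
    -- gives such a path.
    inner-edges-meet⇒acyclic : Acyclic G
    inner-edges-meet⇒acyclic (_ , []     , () , _)
    inner-edges-meet⇒acyclic (_ , _ ∷ [] , s≤s () , _)
    inner-edges-meet⇒acyclic (_ , _ ∷ _ ∷ [] , _ , _ ,
        (v≢y₁ ∷ v≢y₂ ∷ []) ∷ (y₁≢y₂ ∷ []) ∷ _ , e₀₁ ∷ e₁₂ ∷ e₂₀ ∷ [-]) =
      no-long-path e₀₁ e₁₂ e₂₀ e₀₁ e₁₂ v≢y₂ (≢-sym v≢y₁) (≢-sym y₁≢y₂) v≢y₂ (≢-sym v≢y₂)
    inner-edges-meet⇒acyclic (_ , _ ∷ _ ∷ _ ∷ [] , _ , _ ,
        (_ ∷ v≢y₂ ∷ _) ∷ (_ ∷ y₁≢y₃ ∷ _) ∷ (y₂≢y₃ ∷ _) ∷ _ , e₀₁ ∷ e₁₂ ∷ e₂₃ ∷ e₃₀ ∷ [-]) =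
      no-long-path e₀₁ e₁₂ e₂₃ e₃₀ e₀₁ v≢y₂ y₁≢y₃ (≢-sym v≢y₂) (≢-sym y₁≢y₃) y₂≢y₃
    inner-edges-meet⇒acyclic (_ , _ ∷ _ ∷ _ ∷ _ ∷ [] , _ , _ ,
        (_ ∷ v≢y₂ ∷ v≢y₃ ∷ _) ∷ (_ ∷ y₁≢y₃ ∷ _) ∷ (y₂≢y₃ ∷ y₂≢y₄ ∷ _) ∷ _ ,
        e₀₁ ∷ e₁₂ ∷ e₂₃ ∷ e₃₄ ∷ e₄₀ ∷ [-]) =
      no-long-path e₀₁ e₁₂ e₂₃ e₃₄ e₄₀ v≢y₂ y₁≢y₃ y₂≢y₄ (≢-sym v≢y₃) y₂≢y₃
    inner-edges-meet⇒acyclic (_ , _ ∷ _ ∷ _ ∷ _ ∷ _ ∷ _ , _ , _ ,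
        (_ ∷ v≢y₂ ∷ _) ∷ (_ ∷ y₁≢y₃ ∷ _) ∷ (y₂≢y₃ ∷ y₂≢y₄ ∷ _) ∷ (_ ∷ y₃≢y₅ ∷ _) ∷ _ ,
        e₀₁ ∷ e₁₂ ∷ e₂₃ ∷ e₃₄ ∷ e₄₅ ∷ _) =
      no-long-path e₀₁ e₁₂ e₂₃ e₃₄ e₄₅ v≢y₂ y₁≢y₃ y₂≢y₄ y₃≢y₅ y₂≢y₃

  hub-tree : Symmetric Adj → ∀ c → (∀ u → Vert u → Walk G u c) → InnerEdgesMeet c → IsTree G
  hub-tree Adj-sym c reach inner = connected-via-hub Adj-sym c reach , inner-edges-meet⇒acyclic inner


window-init : ∀ {k} (x : Config k) i w b → Window x i (w ∷ʳ b) → Window x i w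
window-init x i []      b _          = tt
window-init x i (a ∷ w) b (xi , win) = xi , window-init x (i +ℤ 1ℤ) w b win

length-∷ʳ : ∀ {A : Set} (w : List A) b → length (w ∷ʳ b) ≡ suc (length w)
length-∷ʳ w b = trans (ListP.length-++ w) (+-comm (length w) 1)

module Language (em : ExcludedMiddle 0ℓ) {k : ℕ} (X : ShiftSpace k) where

  drop-left : ∀ a w → InL X (a ∷ w) → InL X w
  drop-left a w (x , i , x∈X , (_ , win)) = x , i +ℤ 1ℤ , x∈X , win

  drop-right : ∀ w b → InL X (w ∷ʳ b) → InL X w
  drop-right w b (x , i , x∈X , win) = x , i , x∈X , window-init x i w b win

  left-extension : ∀ w → InL X w → Σ (Fin k) (L₁ X w)
  left-extension w (x , i , x∈X , win) =
    x (i -ℤ 1ℤ) , x , i -ℤ 1ℤ , x∈X , refl , subst (λ j → Window x j w) (sym i-1+1≡i) win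
    where
    i-1+1≡i : (i -ℤ 1ℤ) +ℤ 1ℤ ≡ i
    i-1+1≡i = trans (ℤP.+-assoc i (ℤ.- 1ℤ) 1ℤ) (ℤP.+-identityʳ i)

  L₁-∷ʳ : ∀ {w b a} → L₁ X (w ∷ʳ b) a → L₁ X w a
  L₁-∷ʳ {w} {b} {a} = drop-right (a ∷ w) b

  ℓ : Word k → ℕ
  ℓ w = proj₁ (card-exists em (L₁ X w))

  ℓ-card : ∀ w → HasCard (L₁ X w) (ℓ w)
  ℓ-card w = proj₂ (card-exists em (L₁ X w))

  ℓ-∷ʳ : ∀ w b → ℓ (w ∷ʳ b) ≤ ℓ w
  ℓ-∷ʳ w b = card-mono (λ _ → L₁-∷ʳ) (ℓ-card (w ∷ʳ b)) (ℓ-card w)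

  ℓ-card-∷ʳ : ∀ {w b} → ℓ (w ∷ʳ b) ≡ ℓ w → HasCard (L₁ X (w ∷ʳ b)) (ℓ w)
  ℓ-card-∷ʳ {w} {b} same = subst (HasCard (L₁ X (w ∷ʳ b))) same (ℓ-card (w ∷ʳ b))

  L₁-∷ʳ-⊇ : ∀ {w b m} → HasCard (L₁ X (w ∷ʳ b)) m → HasCard (L₁ X w) m →
            ∀ a → L₁ X w a → L₁ X (w ∷ʳ b) a
  L₁-∷ʳ-⊇ = card-⊆-⊇ em (λ _ → L₁-∷ʳ)

  left-special : ∀ {w a a'} → InL X w → a ≢ a' → L₁ X w a → L₁ X w a' → LeftSpecial X w
  left-special {w} w∈L a≢a' pa pa' = w∈L , ℓ w , ℓ-card w , two⇒card>1 _ _ a≢a' pa pa' (ℓ-card w)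

  two-left-extensions : ∀ {w} → LeftSpecial X w →
                        Σ (Fin k) λ a → Σ (Fin k) λ a' → a ≢ a' × L₁ X w a × L₁ X w a'
  two-left-extensions (_ , _ , c , 1<n) = card>1⇒two 1<n c

  ℓ-left-special : ∀ {w} → LeftSpecial X w → 1 < ℓ w
  ℓ-left-special {w} (_ , _ , c , 1<n) = subst (1 <_) (card-unique c (ℓ-card w)) 1<n

  left-special-init : ∀ {w b} → LeftSpecial X (w ∷ʳ b) → LeftSpecial X w
  left-special-init {w} {b} ls with two-left-extensions ls
  ... | _ , _ , a≢a' , pa , pa' = left-special (drop-right w b (proj₁ ls)) a≢a' (L₁-∷ʳ pa) (L₁-∷ʳ pa')

  E₁-sym : ∀ w → Symmetric (Graph.Adj (E₁ X w))
  E₁-sym w {inj₁ _} {inj₂ _} e = e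
  E₁-sym w {inj₂ _} {inj₁ _} e = e
  E₁-sym w {inj₁ _} {inj₁ _} ()
  E₁-sym w {inj₂ _} {inj₂ _} ()

  -- Every vertex of ℰ₁(w) reaches c as soon as every left letter does, since
  -- a right letter b is joined to the left letters of wb.
  E₁-reach : ∀ w c → (∀ a → L₁ X w a → Walk (E₁ X w) (inj₁ a) c) →
             ∀ u → Graph.Vert (E₁ X w) u → Walk (E₁ X w) u c
  E₁-reach w c reach (inj₁ a) va = reach a va
  E₁-reach w c reach (inj₂ b) vb with left-extension (w ∷ʳ b) vb
  ... | a , awb = step vb awb (reach a (L₁-∷ʳ awb))

  E₁-inner-right : ∀ w b₀ →
    (∀ {a a' b} → a ≢ a' → InL X (a ∷ (w ∷ʳ b)) → InL X (a' ∷ (w ∷ʳ b)) → b ≡ b₀) →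
    InnerEdgesMeet (E₁ X w) (inj₂ b₀)
  E₁-inner-right w b₀ branching {inj₁ _} {inj₂ _} {inj₁ _} ab ba' _ p≢s _ =
    inj₁ (cong inj₂ (branching (λ { refl → p≢s refl }) ab ba'))
  E₁-inner-right w b₀ branching {_} {inj₁ _} {inj₂ _} {inj₁ _} _ ab ba' _ r≢q =
    inj₂ (cong inj₂ (branching (λ { refl → r≢q refl }) ab ba'))
  E₁-inner-right w b₀ branching {inj₂ _} {inj₂ _} () _ _ _ _
  E₁-inner-right w b₀ branching {inj₁ _} {inj₁ _} () _ _ _ _
  E₁-inner-right w b₀ branching {inj₂ _} {inj₁ _} {inj₁ _} _ () _ _ _
  E₁-inner-right w b₀ branching {_} {inj₁ _} {inj₂ _} {inj₂ _} _ _ () _ _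
  E₁-inner-right w b₀ branching {_} {inj₂ _} {inj₂ _} _ () _ _ _

  E₁-inner-left : ∀ w a₀ → (∀ {a b} → InL X (a ∷ (w ∷ʳ b)) → a ≡ a₀) →
                  InnerEdgesMeet (E₁ X w) (inj₁ a₀)
  E₁-inner-left w a₀ only {r = inj₁ _} {inj₂ _} _ e _ _ _ = inj₁ (cong inj₁ (only e))
  E₁-inner-left w a₀ only {r = inj₂ _} {inj₁ _} _ e _ _ _ = inj₂ (cong inj₁ (only e))
  E₁-inner-left w a₀ only {r = inj₁ _} {inj₁ _} _ () _ _ _
  E₁-inner-left w a₀ only {r = inj₂ _} {inj₂ _} _ () _ _ _

  -- In an acyclic ℰ₁(w), an extension wb₀ with ℓ(wb₀) = ℓ(w) leaves no other
  -- extension left special: left letters a ≠ a' of wb would close the cycle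
  -- a, b₀, a', b.
  only-left-special-extension : ∀ {w b₀ b} → Acyclic (E₁ X w) → InL X (w ∷ʳ b₀) →
    ℓ (w ∷ʳ b₀) ≡ ℓ w → LeftSpecial X (w ∷ʳ b) → b ≡ b₀
  only-left-special-extension {w} {b₀} {b} acyclic wb₀∈L same lsb with b ≟ b₀
  ... | yes b≡b₀ = b≡b₀
  ... | no b≢b₀ with two-left-extensions lsb
  ...   | a , a' , a≢a' , awb , a'wb = ⊥-elim (acyclic
            (four-cycle (E₁ X w) {inj₁ a} {inj₂ b₀} {inj₁ a'} {inj₂ b}
              (L₁-∷ʳ awb) wb₀∈L (L₁-∷ʳ a'wb) (proj₁ lsb)
              (λ ()) (λ { refl → a≢a' refl }) (λ ()) (λ ()) (λ { refl → b≢b₀ refl }) (λ ())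
              (to-b₀ a (L₁-∷ʳ awb)) (to-b₀ a' (L₁-∷ʳ a'wb)) a'wb awb))
    where
    to-b₀ : ∀ a → L₁ X w a → L₁ X (w ∷ʳ b₀) a
    to-b₀ = L₁-∷ʳ-⊇ (ℓ-card-∷ʳ same) (ℓ-card w)

  unique-extension⇒tree : ∀ n → UniqueLSExtension X n →
                          ∀ w → InL X w → n ≤ length w → IsTree (E₁ X w)
  unique-extension⇒tree n unique w w∈L n≤∣w∣ with em {LeftSpecial X w}
  ... | no ¬ls =
    hub-tree (E₁ X w) (E₁-sym w) (inj₁ a₀) (E₁-reach w (inj₁ a₀) is-a₀)
             (E₁-inner-left w a₀ (only-a₀ ∘ L₁-∷ʳ))
    where
    a₀ : Fin k
    a₀ = proj₁ (left-extension w w∈L)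
    only-a₀ : ∀ {a} → L₁ X w a → a ≡ a₀
    only-a₀ {a} va with a ≟ a₀
    ... | yes a≡a₀ = a≡a₀
    ... | no a≢a₀  = ⊥-elim (¬ls (left-special w∈L a≢a₀ va (proj₂ (left-extension w w∈L))))
    is-a₀ : ∀ a → L₁ X w a → Walk (E₁ X w) (inj₁ a) (inj₁ a₀)
    is-a₀ a va with only-a₀ va
    ... | refl = here va
  ... | yes ls with unique w (ls , n≤∣w∣)
  ...   | b₀ , ((wb₀∈L , _) , _) , only-b₀ , _ , c₀ , c =
    hub-tree (E₁ X w) (E₁-sym w) (inj₂ b₀) (E₁-reach w (inj₂ b₀) joined-to-b₀)
             (E₁-inner-right w b₀ branching⇒b₀)
    where
    -- L₁(wb₀) = L₁(w): every left letter is joined to b₀.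
    joined-to-b₀ : ∀ a → L₁ X w a → Walk (E₁ X w) (inj₁ a) (inj₂ b₀)
    joined-to-b₀ a va = step va (L₁-∷ʳ-⊇ c₀ c a va) (here wb₀∈L)
    -- A right letter b with two left neighbours makes wb left special.
    branching⇒b₀ : ∀ {a a' b} → a ≢ a' → InL X (a ∷ (w ∷ʳ b)) → InL X (a' ∷ (w ∷ʳ b)) → b ≡ b₀
    branching⇒b₀ {a} {b = b} a≢a' awb a'wb =
      only-b₀ b (left-special (drop-left a _ awb) a≢a' awb a'wb ,
                 subst (suc n ≤_) (sym (length-∷ʳ w b)) (s≤s n≤∣w∣))

  potential : Word k → ℕ
  potential v = weight (em {LeftSpecial X v}) (suc k ^ ℓ v)

  passed : Word k → ℕ
  passed v = ∑[ b < k ] potential (v ∷ʳ b)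

  SameℓExtension : Word k → Set
  SameℓExtension v = Σ (Fin k) λ b₀ → LeftSpecial X (v ∷ʳ b₀) × ℓ (v ∷ʳ b₀) ≡ ℓ v

  passed-not-left-special : ∀ {v} → ¬ LeftSpecial X v → passed v ≡ 0
  passed-not-left-special {v} ¬ls =
    trans (sum-cong-≗ extensions-weightless) (sum-replicate-zero k)
    where
    extensions-weightless : ∀ b → potential (v ∷ʳ b) ≡ 0
    extensions-weightless b = weight-no em (¬ls ∘ left-special-init)

  -- In an acyclic ℰ₁(v), an extension of the same multiplicity is the only
  -- left-special one, so it takes over exactly the weight of v.
  passed-same-ℓ : ∀ {v} → Acyclic (E₁ X v) → LeftSpecial X v → SameℓExtension v →
                  passed v ≡ potential v
  passed-same-ℓ {v} acyclic ls (b₀ , ls₀ , same) = begin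
    passed v             ≡⟨ sum-supported _ b₀ not-left-special ⟩
    potential (v ∷ʳ b₀)  ≡⟨ weight-yes em ls₀ ⟩
    suc k ^ ℓ (v ∷ʳ b₀)  ≡⟨ cong (suc k ^_) same ⟩
    suc k ^ ℓ v          ≡⟨ weight-yes em ls ⟨
    potential v          ∎
    where
    open ≡-Reasoning
    not-left-special : ∀ b → b ≢ b₀ → potential (v ∷ʳ b) ≡ 0
    not-left-special b b≢b₀ =
      weight-no em (b≢b₀ ∘ only-left-special-extension acyclic (proj₁ ls₀) same)

  -- Otherwise every extension weighs at most (k+1)^(ℓ(v)-1), and as
  -- k·(k+1)^(ℓ(v)-1) < (k+1)^ℓ(v) the weight strictly drops.
  passed-drop : ∀ {v} → LeftSpecial X v → ¬ SameℓExtension v → passed v < potential v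
  passed-drop {v} ls none = begin-strict
    passed v                   ≤⟨ sum-bound extension-bound ⟩
    k * suc k ^ pred (ℓ v)     <⟨ *-monoˡ-< (suc k ^ pred (ℓ v)) {{m^n≢0 (suc k) (pred (ℓ v))}} (n<1+n k) ⟩
    suc k ^ suc (pred (ℓ v))   ≡⟨ cong (suc k ^_) (suc-pred (ℓ v) {{>-nonZero (<⇒≤ (ℓ-left-special ls))}}) ⟩
    suc k ^ ℓ v                ≡⟨ weight-yes em ls ⟨
    potential v                ∎
    where
    open ≤-Reasoning
    extension-bound : ∀ b → potential (v ∷ʳ b) ≤ suc k ^ pred (ℓ v)
    extension-bound b = weight-bound em λ lsb →
      ^-monoʳ-≤ (suc k) (<⇒≤pred (≤∧≢⇒< (ℓ-∷ʳ v b) (λ same → none (b , lsb , same))))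

  passed-≤ : ∀ {v} → (InL X v → Acyclic (E₁ X v)) → passed v ≤ potential v
  passed-≤ {v} acyclic = case em {LeftSpecial X v} of λ where
    (no ¬ls) → ≤-trans (≤-reflexive (passed-not-left-special ¬ls)) z≤n
    (yes ls) → case em {SameℓExtension v} of λ where
      (yes same) → ≤-reflexive (passed-same-ℓ (acyclic (proj₁ ls)) ls same)
      (no none)  → <⇒≤ (passed-drop ls none)

  Φ : ℕ → ℕ
  Φ N = sumWords N potential

  module _ (m : ℕ) (tree : ∀ w → InL X w → m ≤ length w → IsTree (E₁ X w)) where

    passed-≤-from : ∀ N → m ≤ N → ∀ u → length u ≡ N → passed u ≤ potential u
    passed-≤-from N m≤N u ∣u∣ = passed-≤ λ u∈L → proj₂ (tree u u∈L (subst (m ≤_) (sym ∣u∣) m≤N))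

    Φ-antitone : ∀ N → m ≤ N → Φ (suc N) ≤ Φ N
    Φ-antitone N m≤N =
      subst (_≤ Φ N) (sym (sumWords-∷ʳ N potential)) (sumWords-mono N (passed-≤-from N m≤N))

    Φ-drop : ∀ {w} → m ≤ length w → LeftSpecial X w → ¬ SameℓExtension w →
             Φ (suc (length w)) < Φ (length w)
    Φ-drop {w} m≤∣w∣ ls none =
      subst (_< Φ (length w)) (sym (sumWords-∷ʳ (length w) potential))
            (sumWords-strict (length w) (passed-≤-from (length w) m≤∣w∣) w refl (passed-drop ls none))

    -- Where Φ is constant, every left-special word has an extension of the
    -- same multiplicity, which is its only left-special extension.
    unique-extension-where-constant : ∀ N₀ → m ≤ N₀ → (∀ N → N₀ ≤ N → Φ (suc N) ≡ Φ N) →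
                                      UniqueLSExtension X N₀
    unique-extension-where-constant N₀ m≤N₀ constant w (ls , N₀≤∣w∣) =
      case em {SameℓExtension w} of λ where
        (yes (b₀ , ls₀ , same)) →
          b₀ , (ls₀ , subst (suc N₀ ≤_) (sym (length-∷ʳ w b₀)) (s≤s N₀≤∣w∣)) ,
          (λ b (lsb , _) → only-left-special-extension acyclic (proj₁ ls₀) same lsb) ,
          ℓ w , ℓ-card-∷ʳ same , ℓ-card w
        (no none) → ⊥-elim (<-irrefl (constant (length w) N₀≤∣w∣) (Φ-drop m≤∣w∣ ls none))
      where
      m≤∣w∣ : m ≤ length w
      m≤∣w∣ = ≤-trans m≤N₀ N₀≤∣w∣
      acyclic : Acyclic (E₁ X w)
      acyclic = proj₂ (tree w (proj₁ ls) m≤∣w∣)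

  -- (⇒) Φ is nonincreasing from m on, hence eventually constant.
  tree⇒unique-extension : EventuallyDendric X → Σ ℕ (UniqueLSExtension X)
  tree⇒unique-extension (m , tree) with eventually-constant em Φ m (Φ-antitone m tree)
  ... | N₀ , m≤N₀ , constant = N₀ , unique-extension-where-constant m tree N₀ m≤N₀ constant


proposition3p5 : ExcludedMiddle 0ℓ → (k : ℕ) → (X : ShiftSpace k) →
    EventuallyDendric X ⇔ Σ ℕ (λ n → UniqueLSExtension X n)
proposition3p5 em k X =
  mk⇔ tree⇒unique-extension (λ (n , unique) → n , unique-extension⇒tree n unique)
  where open Language em X
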